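{- Let $(H,\omega)$ be an edge-weighted graph whose edge weights are positive multiples of $a=45$, let $u\in V(H)$, and let $(C,f)$ be the caterpillar layout of the gadget $\mathcal G(u)$. Then for every cut $(A,B)$ of $V(\mathcal G(u))$ induced by an edge of $C$, the maximum size of an induced matching of the bipartite graph formed by the edges of $\mathcal G(u)$ between $A$ and $B$ is at most $7$.
   Context: Fix $a=45$, $\tau=1080$, $\gamma=135$, $b=6\tau(\tau+\gamma)+1$. For $uv\in E(H)$ let $I(u,v)$ be a set of $\omega(uv)$ vertices, partitioned into $I(u,v,1),\dots,I(u,v,a)$ each of size $\omega(uv)/a$; let $v_1,\dots,v_k$ enumerate $N_H(u)$ and $S(u)=\bigcup_j I(u,v_j)$. For $i\in[a]$ let $L_i$ be a path on $I(u,v_1,i)\cup\dots\cup I(u,v_k,i)$ visiting these sets in this order; let $L$ be the concatenation $L_1L_2\dots L_a$ (last vertex of $L_i$ adjacent to first of $L_{i+1}$). The path $P_u$ is obtained from the 1-subdivision of $L$ by adding a new vertex adjacent to the last vertex of $L$. The path $Q_u$ is the concatenation of $b$ copies $P_u^1,\dots,P_u^b$ of $P_u$; for a vertex $x$ of $P_u$ (or one of its copies), $\mathrm{Copies}(x)$ is the set of its $b$ copies in $Q_u$. The gadget $\mathcal G(u)$ is obtained from $Q_u$ by adding an edge between every pair of vertices $x,y$ lying in two distinct copies $P_u^i,P_u^j$, except when $y\in N_{Q_u}[\mathrm{Copies}(x)]$ (the closed neighborhood in $Q_u$ of the set $\mathrm{Copies}(x)$). The caterpillar layout $(C,f)$ of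 $\mathcal G(u)$ is the rooted full binary tree whose internal nodes form a path and in which every right child is a leaf, with $f$ a bijection from $V(\mathcal G(u))$ to its leaves placing the vertices in the order of $Q_u$ from the first vertex of $P_u^1$ to the last vertex of $P_u^b$. An edge of $C$ induces the cut given by the preimages of the leaves on either side. -}

module Defs where

open import Data.Nat using (ℕ; zero; suc; _+_; _*_; _<_; _≤_)
open import Data.Nat.DivMod using (_/_)
open import Data.Nat.Divisibility using (_∣_)
open import Data.Fin using (Fin)
open import Data.List using (List; []; _∷_; map; concatMap; upTo; allFin; foldl; _++_)
open import Data.List.Membership.Propositional using (_∈_)
open import Data.List.Relation.Unary.Unique.Propositional using (Unique)
open import Data.Product using (Σ; _×_; _,_; proj₁; proj₂)
open import Data.Sum using (_⊎_)
open import Relation.Nullary using (¬_)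
open import Relation.Binary.PropositionalEquality using (_≡_; _≢_)

a : ℕ
a = 45

τ : ℕ
τ = 1080

γ : ℕ
γ = 135

b : ℕ
b = 6 * τ * (τ + γ) + 1

record WGraph : Set₁ where
  field
    n         : ℕ
    Adj       : Fin n → Fin n → Set
    Adj-sym   : ∀ x y → Adj x y → Adj y x
    Adj-irr   : ∀ x → ¬ Adj x x
    ω         : Fin n → Fin n → ℕ      -- only meaningful on edges
    ω-sym     : ∀ x y → ω x y ≡ ω y x

open WGraph public

WeightsPosMultOf : ℕ → WGraph → Set
WeightsPosMultOf k H = ∀ x y → Adj H x y → (k ∣ ω H x y) × (0 < ω H x y)

-- vs enumerates N_H(u) (without repetition), v_1, ..., v_k in list order
Enumerates : (H : WGraph) → Fin (n H) → List (Fin (n H)) → Set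
Enumerates H u vs =
  Unique vs × ((∀ v → v ∈ vs → Adj H u v) × (∀ v → Adj H u v → v ∈ vs))

-- The path L.  The vertex (v , i , t) is the t-th vertex of I(u,v,i),
-- t < ω(uv)/a.

LVtx : ℕ → Set
LVtx m = Fin m × Fin a × ℕ

Ipart : (H : WGraph) → Fin (n H) → Fin (n H) → Fin a → List (LVtx (n H))
Ipart H u v i = map (λ t → (v , i , t)) (upTo (ω H u v / a))

Lpart : (H : WGraph) → Fin (n H) → List (Fin (n H)) → Fin a → List (LVtx (n H))
Lpart H u vs i = concatMap (λ v → Ipart H u v i) vs

Lpath : (H : WGraph) → Fin (n H) → List (Fin (n H)) → List (LVtx (n H))
Lpath H u vs = concatMap (Lpart H u vs) (allFin a)

-- P_u: 1-subdivision of L plus a new vertex after the last vertex of L.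

data PVtx (X : Set) : Set where
  orig : X → PVtx X
  subd : X → PVtx X          -- subdivision vertex of the edge leaving x in L
  new  : PVtx X

subdivPlus : {X : Set} → List X → List (PVtx X)
subdivPlus []            = new ∷ []
subdivPlus (x ∷ [])      = orig x ∷ new ∷ []
subdivPlus (x ∷ y ∷ xs)  = orig x ∷ subd x ∷ subdivPlus (y ∷ xs)

Ppath : (H : WGraph) → Fin (n H) → List (Fin (n H)) → List (PVtx (LVtx (n H)))
Ppath H u vs = subdivPlus (Lpath H u vs)

-- Q_u = P_u^1 ... P_u^b, and the gadget, for a generic path P.
-- A vertex of Q_u is (c , x): the copy of x in P^c.

QVtx : Set → Set
QVtx X = Fin b × X

Qpath : {X : Set} → List X → List (QVtx X)
Qpath P = concatMap (λ c → map (λ x → (c , x)) P) (allFin b)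

data Consec {X : Set} : List X → X → X → Set where
  here  : ∀ {x y xs} → Consec (x ∷ y ∷ xs) x y
  there : ∀ {z x y xs} → Consec xs x y → Consec (z ∷ xs) x y

QAdj : {X : Set} → List X → QVtx X → QVtx X → Set
QAdj P x y = Consec (Qpath P) x y ⊎ Consec (Qpath P) y x

-- y ∈ N_{Q_u}[Copies(x)]
InClosedNbhdCopies : {X : Set} → List X → QVtx X → QVtx X → Set
InClosedNbhdCopies P x y =
  Σ (QVtx _) λ z → (proj₂ z ≡ proj₂ x) × ((y ≡ z) ⊎ QAdj P y z)

-- the added (non-path) edges, one orientation of the rule
AddedEdge : {X : Set} → List X → QVtx X → QVtx X → Set
AddedEdge P x y = (proj₁ x ≢ proj₁ y) × ¬ InClosedNbhdCopies P x y

-- edge relation of the gadget G(u) (vertex set = entries of Qpath P)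
GEdge : {X : Set} → List X → QVtx X → QVtx X → Set
GEdge P x y = QAdj P x y ⊎ (AddedEdge P x y ⊎ AddedEdge P y x)

data Tree (X : Set) : Set where
  empty : Tree X
  leaf  : X → Tree X
  node  : Tree X → Tree X → Tree X

leaves : {X : Set} → Tree X → List X
leaves empty      = []
leaves (leaf x)   = x ∷ []
leaves (node l r) = leaves l ++ leaves r

-- caterpillar: internal nodes form a path, every right child is a leaf,
-- leaves from left to right are the list entries in order
caterpillar : {X : Set} → List X → Tree X
caterpillar []       = empty
caterpillar (x ∷ xs) = foldl (λ t y → node t (leaf y)) (leaf x) xs

-- s is a non-root node of t; these correspond exactly to the edges of t
-- (the edge from s to its parent)
data NonRootNode {X : Set} : Tree X → Tree X → Set where
  left   : ∀ {l r} → NonRootNode l (node l r)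
  right  : ∀ {l r} → NonRootNode r (node l r)
  inLeft  : ∀ {s l r} → NonRootNode s l → NonRootNode s (node l r)
  inRight : ∀ {s l r} → NonRootNode s r → NonRootNode s (node l r)

IsInducedMatching : {V : Set} → (V → Set) → (V → Set) → (V → V → Set) →
                    (m : ℕ) → (Fin m → V × V) → Set
IsInducedMatching A B E m M =
  (∀ i → A (proj₁ (M i)) × B (proj₂ (M i)) × E (proj₁ (M i)) (proj₂ (M i)))
  × (∀ i j → i ≢ j → ¬ E (proj₁ (M i)) (proj₂ (M j)))

{-# OPTIONS --safe #-}
module Submission where

open import Defs
open import Data.Nat using (ℕ; zero; suc; pred; _+_; _*_; _≤_; _<_; _≟_; _<?_; z≤n; s≤s; z<s; s<s; NonZero)
open import Data.Nat.Properties
open import Data.Nat.DivMod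
open import Data.Nat.Divisibility using (n∣m*n)
open import Data.Fin as Fin using (Fin; toℕ; fromℕ<)
import Data.Fin.Properties as Fin
open import Data.Fin.Properties using (toℕ-injective; toℕ-fromℕ<; injective⇒≤; any?)
open import Data.List
  using (List; []; _∷_; _++_; map; concatMap; length; lookup; tabulate; allFin; cartesianProduct; foldl)
open import Data.List.Properties using (length-map; ++-assoc)
open import Data.List.Membership.Propositional using (_∈_; _∉_)
open import Data.List.Membership.Propositional.Properties
  using ( ∈-map⁺; ∈-map⁻; ∈-lookup; ∈-++⁺ˡ; ∈-++⁺ʳ; ∈-concatMap⁻; ∈-allFin
        ; ∈-cartesianProduct⁺; ∈-cartesianProduct⁻)
open import Data.List.Relation.Unary.Any using (here; there; satisfied)
import Data.List.Relation.Unary.Any as Any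
open import Data.List.Relation.Unary.Any.Properties using (lookup-index)
import Data.List.Relation.Unary.All as All
import Data.List.Relation.Unary.All.Properties as All
import Data.List.Relation.Unary.AllPairs as AllPairs
import Data.List.Relation.Unary.AllPairs.Properties as AllPairs
open import Data.List.Relation.Unary.Unique.Propositional using (Unique; []; _∷_)
open import Data.List.Relation.Unary.Unique.Propositional.Properties
  using (concat⁺; map⁺; upTo⁺; allFin⁺; cartesianProduct⁺; Unique[x∷xs]⇒x∉xs)
open import Data.List.Relation.Binary.Disjoint.Propositional using (Disjoint)
open import Data.Product using (Σ; ∃-syntax; _×_; _,_; proj₁; proj₂)
open import Data.Product.Properties using (≡-dec)
open import Data.Sum using (_⊎_; inj₁; inj₂; [_,_]′)
open import Data.Sum.Properties using (inj₁-injective; inj₂-injective)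
import Data.Sum as Sum
open import Data.Empty using (⊥-elim)
open import Function using (_∘_; id)
open import Function.Definitions using (Injective)
open import Relation.Nullary using (¬_; Dec; yes; no; contradiction; ¬?)
open import Relation.Nullary.Decidable using (map′; _⊎-dec_)
open import Relation.Binary using (DecidableEquality)
open import Relation.Binary.PropositionalEquality

-- Number the vertices of P by 0, …, N − 1, their phase.  The vertex at position t of
-- Q = P¹ ⋯ Pᵇ is the copy t / N of the vertex of phase t mod N, so every vertex of
-- N_Q[Copies(x)] has a phase equal or cyclically adjacent ("near") to that of x; conversely an
-- added edge xy between near phases forces y to be an end of Q, where the copy of x next to y
-- is missing.  A cut of the caterpillar layout is a prefix of Q or a single leaf.  Across a
-- prefix cut at most three matching edges have near endpoint phases: the path edge over the
-- cut and edges at the two ends of Q.  For the remaining (far) edges, the non-edge x_k y_l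
-- forces near phases whenever x_k and y_l lie in different copies, and only the copy containing
-- the cut has vertices on both sides.  Hence, fixing one far edge x_f y_f, either every other
-- far y_k has a phase near that of x_f or every other far x_k has a phase near that of y_f,
-- which leaves at most 1 + 3 far edges.  Neither the weights nor the number b of copies
-- matter: the bound holds for the gadget of any path with distinct vertices.

injective-into-list⇒≤ : ∀ {A : Set} {m} {f : Fin m → A} {xs : List A} →
                        Injective _≡_ _≡_ f → (∀ k → f k ∈ xs) → m ≤ length xs
injective-into-list⇒≤ {xs = xs} f-injective f∈xs = injective⇒≤ index-injective
  where
  index-injective : Injective _≡_ _≡_ (λ k → Any.index (f∈xs k))
  index-injective {k} {l} eq = f-injective (begin
    _ ≡⟨ lookup-index (f∈xs k) ⟩
    lookup xs (Any.index (f∈xs k)) ≡⟨ cong (lookup xs) eq ⟩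
    lookup xs (Any.index (f∈xs l)) ≡⟨ lookup-index (f∈xs l) ⟨
    _ ∎)
    where open ≡-Reasoning

module _ {V : Set} (E : V → V → Set) {m} (M : Fin m → V × V)
         (edge : ∀ k → E (proj₁ (M k)) (proj₂ (M k)))
         (non-edge : ∀ k l → k ≢ l → ¬ E (proj₁ (M k)) (proj₂ (M l))) where

  inducedMatching-injectiveˡ : Injective _≡_ _≡_ (proj₁ ∘ M)
  inducedMatching-injectiveˡ {k} {l} eq with k Fin.≟ l
  ... | yes k≡l = k≡l
  ... | no k≢l = ⊥-elim (non-edge k l k≢l (subst (λ v → E v (proj₂ (M l))) (sym eq) (edge l)))

  inducedMatching-injectiveʳ : Injective _≡_ _≡_ (proj₂ ∘ M)
  inducedMatching-injectiveʳ {k} {l} eq with k Fin.≟ l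
  ... | yes k≡l = k≡l
  ... | no k≢l = ⊥-elim (non-edge k l k≢l (subst (E (proj₁ (M k))) eq (edge k)))

concatMap⁺ : ∀ {A B : Set} {f : A → List B} (tag : B → A) →
             (∀ x {y} → y ∈ f x → tag y ≡ x) → (∀ x → Unique (f x)) →
             ∀ {xs} → Unique xs → Unique (concatMap f xs)
concatMap⁺ {f = f} tag tagged f-unique xs-unique =
  concat⁺ (All.map⁺ (All.universal f-unique _)) (AllPairs.map⁺ (AllPairs.map disjoint xs-unique))
  where
  disjoint : ∀ {x x′} → x ≢ x′ → Disjoint (f x) (f x′)
  disjoint x≢x′ (y∈fx , y∈fx′) = x≢x′ (trans (sym (tagged _ y∈fx)) (tagged _ y∈fx′))

Consec-∈ˡ : ∀ {X : Set} {xs : List X} {x y} → Consec xs x y → x ∈ xs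
Consec-∈ˡ here      = here refl
Consec-∈ˡ (there c) = there (Consec-∈ˡ c)

Consec-∈ʳ : ∀ {X : Set} {xs : List X} {x y} → Consec xs x y → y ∈ xs
Consec-∈ʳ here      = there (here refl)
Consec-∈ʳ (there c) = there (Consec-∈ʳ c)

module Position {X : Set} (_≟ˣ_ : DecidableEquality X) where

  position : List X → X → ℕ
  position []       x = 0
  position (y ∷ ys) x with x ≟ˣ y
  ... | yes _ = 0
  ... | no  _ = suc (position ys x)

  position-here : ∀ x xs → position (x ∷ xs) x ≡ 0
  position-here x xs with x ≟ˣ x
  ... | yes _   = refl
  ... | no x≢x = contradiction refl x≢x

  position-there : ∀ {x y} ys → x ≢ y → position (y ∷ ys) x ≡ suc (position ys x)
  position-there {x} {y} ys x≢y with x ≟ˣ y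
  ... | yes x≡y = contradiction x≡y x≢y
  ... | no _    = refl

  position-< : ∀ {x xs} → x ∈ xs → position xs x < length xs
  position-< {x} {y ∷ ys} x∈ with x ≟ˣ y
  position-< {x} {y ∷ ys} x∈          | yes _   = z<s
  position-< {x} {y ∷ ys} (here x≡y)  | no x≢y = contradiction x≡y x≢y
  position-< {x} {y ∷ ys} (there x∈) | no _    = s<s (position-< x∈)

  position-injective : ∀ {x y xs} → x ∈ xs → y ∈ xs → position xs x ≡ position xs y → x ≡ y
  position-injective {x} {y} {z ∷ zs} x∈ y∈ eq with x ≟ˣ z | y ≟ˣ z
  ... | yes x≡z | yes y≡z = trans x≡z (sym y≡z)
  position-injective (here x≡z) _ _ | no x≢z | _ = contradiction x≡z x≢z
  position-injective _ (here y≡z) _ | _ | no y≢z = contradiction y≡z y≢z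
  position-injective (there x∈) (there y∈) eq | no _ | no _ = position-injective x∈ y∈ (suc-injective eq)

  position-lookup : ∀ {xs} → Unique xs → ∀ i → position xs (lookup xs i) ≡ toℕ i
  position-lookup {x ∷ xs} _ Fin.zero = position-here x xs
  position-lookup {x ∷ xs} u@(_ ∷ xs-unique) (Fin.suc i) =
    trans (position-there xs (λ eq → Unique[x∷xs]⇒x∉xs u (subst (_∈ xs) eq (∈-lookup i))))
          (cong suc (position-lookup xs-unique i))

  position-++ˡ : ∀ {x} xs ys → x ∈ xs → position (xs ++ ys) x ≡ position xs x
  position-++ˡ {x} (z ∷ zs) ys x∈ with x ≟ˣ z
  position-++ˡ (z ∷ zs) ys x∈          | yes _   = refl
  position-++ˡ (z ∷ zs) ys (here x≡z)  | no x≢z = contradiction x≡z x≢z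
  position-++ˡ (z ∷ zs) ys (there x∈) | no _    = cong suc (position-++ˡ zs ys x∈)

  position-++ʳ : ∀ {x} xs ys → x ∉ xs → position (xs ++ ys) x ≡ length xs + position ys x
  position-++ʳ []       ys x∉ = refl
  position-++ʳ {x} (z ∷ zs) ys x∉ = begin
    position (z ∷ zs ++ ys) x       ≡⟨ position-there (zs ++ ys) (x∉ ∘ here) ⟩
    suc (position (zs ++ ys) x)     ≡⟨ cong suc (position-++ʳ zs ys (x∉ ∘ there)) ⟩
    suc (length zs + position ys x) ∎
    where open ≡-Reasoning

  Consec⇒position-suc : ∀ {xs x y} → Unique xs → Consec xs x y → position xs y ≡ suc (position xs x)
  Consec⇒position-suc {x ∷ y ∷ zs} ((x≢y All.∷ _) ∷ _) here = begin
    position (x ∷ y ∷ zs) y       ≡⟨ position-there (y ∷ zs) (x≢y ∘ sym) ⟩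
    suc (position (y ∷ zs) y)     ≡⟨ cong suc (position-here y zs) ⟩
    1                             ≡⟨ cong suc (position-here x (y ∷ zs)) ⟨
    suc (position (x ∷ y ∷ zs) x) ∎
    where open ≡-Reasoning
  Consec⇒position-suc {z ∷ zs} {x} {y} u@(_ ∷ zs-unique) (there c) = begin
    position (z ∷ zs) y       ≡⟨ position-there zs (not-head (Consec-∈ʳ c)) ⟩
    suc (position zs y)       ≡⟨ cong suc (Consec⇒position-suc zs-unique c) ⟩
    suc (suc (position zs x)) ≡⟨ cong suc (position-there zs (not-head (Consec-∈ˡ c))) ⟨
    suc (position (z ∷ zs) x) ∎
    where
    open ≡-Reasoning
    not-head : ∀ {w} → w ∈ zs → w ≢ z
    not-head w∈zs w≡z = Unique[x∷xs]⇒x∉xs u (subst (_∈ zs) w≡z w∈zs)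

  position≡0⇒head : ∀ {y ys} → y ∈ ys → position ys y ≡ 0 → ∃[ ws ] ys ≡ y ∷ ws
  position≡0⇒head {y} {z ∷ zs} y∈ eq with y ≟ˣ z
  ... | yes refl = zs , refl

  position-suc⇒Consec : ∀ {xs x y} → x ∈ xs → y ∈ xs → position xs y ≡ suc (position xs x) → Consec xs x y
  position-suc⇒Consec {z ∷ zs} {x} {y} x∈ y∈ eq with x ≟ˣ z | y ≟ˣ z
  position-suc⇒Consec _ (here y≡z) _ | _ | no y≢z = contradiction y≡z y≢z
  position-suc⇒Consec {z ∷ zs} _ (there y∈) eq | yes refl | no _
    with position≡0⇒head y∈ (suc-injective eq)
  ... | _ , refl = here
  position-suc⇒Consec (here x≡z) _ _ | no x≢z | no _ = contradiction x≡z x≢z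
  position-suc⇒Consec (there x∈) (there y∈) eq | no _ | no _ =
    there (position-suc⇒Consec x∈ y∈ (suc-injective eq))

open Position using (position; position-here; position-there; position-++ˡ; position-++ʳ)

position-map : ∀ {A B : Set} (_≟ᴬ_ : DecidableEquality A) (_≟ᴮ_ : DecidableEquality B) {f : A → B} →
               Injective _≡_ _≡_ f → ∀ xs x → position _≟ᴮ_ (map f xs) (f x) ≡ position _≟ᴬ_ xs x
position-map _≟ᴬ_ _≟ᴮ_ f-injective [] x = refl
position-map _≟ᴬ_ _≟ᴮ_ {f} f-injective (z ∷ zs) x with x ≟ᴬ z
... | yes refl = position-here _≟ᴮ_ (f x) _
... | no x≢z = begin
  position _≟ᴮ_ (f z ∷ map f zs) (f x) ≡⟨ position-there _≟ᴮ_ (map f zs) (x≢z ∘ f-injective) ⟩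
  suc (position _≟ᴮ_ (map f zs) (f x)) ≡⟨ cong suc (position-map _≟ᴬ_ _≟ᴮ_ f-injective zs x) ⟩
  suc (position _≟ᴬ_ zs x)             ∎
  where open ≡-Reasoning

position-tabulate : ∀ {A : Set} (_≟ᴬ_ : DecidableEquality A) {n} {f : Fin n → A} →
                    Injective _≡_ _≡_ f → ∀ i → position _≟ᴬ_ (tabulate f) (f i) ≡ toℕ i
position-tabulate _≟ᴬ_ {f = f} f-injective Fin.zero = position-here _≟ᴬ_ (f Fin.zero) _
position-tabulate _≟ᴬ_ {f = f} f-injective (Fin.suc i) =
  trans (position-there _≟ᴬ_ _ (Fin.0≢1+n ∘ sym ∘ f-injective))
        (cong suc (position-tabulate _≟ᴬ_ (Fin.suc-injective ∘ f-injective) i))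

position-cartesianProduct :
  ∀ {A B : Set} (_≟ᴬ_ : DecidableEquality A) (_≟ᴮ_ : DecidableEquality B) {xs ys x y} →
  x ∈ xs → y ∈ ys →
  position (≡-dec _≟ᴬ_ _≟ᴮ_) (cartesianProduct xs ys) (x , y) ≡ position _≟ᴬ_ xs x * length ys + position _≟ᴮ_ ys y
position-cartesianProduct _≟ᴬ_ _≟ᴮ_ {z ∷ zs} {ys} {x} {y} x∈ y∈ with x ≟ᴬ z
... | yes refl = begin
  position _≟ᴾ_ (map (x ,_) ys ++ cartesianProduct zs ys) (x , y)
    ≡⟨ position-++ˡ _≟ᴾ_ (map (x ,_) ys) _ (∈-map⁺ (x ,_) y∈) ⟩
  position _≟ᴾ_ (map (x ,_) ys) (x , y)
    ≡⟨ position-map _≟ᴮ_ _≟ᴾ_ (λ { refl → refl }) ys y ⟩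
  position _≟ᴮ_ ys y
    ∎
  where
  open ≡-Reasoning
  _≟ᴾ_ = ≡-dec _≟ᴬ_ _≟ᴮ_
... | no x≢z = begin
  position _≟ᴾ_ (map (z ,_) ys ++ cartesianProduct zs ys) (x , y)
    ≡⟨ position-++ʳ _≟ᴾ_ (map (z ,_) ys) _ outside-first-block ⟩
  length (map (z ,_) ys) + position _≟ᴾ_ (cartesianProduct zs ys) (x , y)
    ≡⟨ cong₂ _+_ (length-map (z ,_) ys) (position-cartesianProduct _≟ᴬ_ _≟ᴮ_ (Any.tail x≢z x∈) y∈) ⟩
  length ys + (position _≟ᴬ_ zs x * length ys + position _≟ᴮ_ ys y)
    ≡⟨ +-assoc (length ys) _ _ ⟨
  suc (position _≟ᴬ_ zs x) * length ys + position _≟ᴮ_ ys y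
    ∎
  where
  open ≡-Reasoning
  _≟ᴾ_ = ≡-dec _≟ᴬ_ _≟ᴮ_
  outside-first-block : (x , y) ∉ map (z ,_) ys
  outside-first-block xy∈ with ∈-map⁻ (z ,_) xy∈
  ... | _ , _ , refl = x≢z refl

-- Caterpillar cuts

PrefixOrLeaf : ∀ {X : Set} → List X → Tree X → Set
PrefixOrLeaf Q s = (∃[ rest ] Q ≡ leaves s ++ rest) ⊎ (∃[ q ] leaves s ≡ q ∷ [])

caterpillar-cut : ∀ {X : Set} (Q : List X) {s} → NonRootNode s (caterpillar Q) → PrefixOrLeaf Q s
caterpillar-cut []      ()
caterpillar-cut (x ∷ xs) = grow (leaf x) xs refl (λ ())
  where
  grow : ∀ t ys → x ∷ xs ≡ leaves t ++ ys → (∀ {s} → NonRootNode s t → PrefixOrLeaf (x ∷ xs) s) →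
         ∀ {s} → NonRootNode s (foldl (λ t y → node t (leaf y)) t ys) → PrefixOrLeaf (x ∷ xs) s
  grow t []       _  old s-in-t = old s-in-t
  grow t (y ∷ ys) eq old =
    grow (node t (leaf y)) ys (trans eq (sym (++-assoc (leaves t) (y ∷ []) ys))) extended
    where
    extended : ∀ {s} → NonRootNode s (node t (leaf y)) → PrefixOrLeaf (x ∷ xs) s
    extended left            = inj₁ (y ∷ ys , eq)
    extended right           = inj₂ (y , refl)
    extended (inLeft s-in-t) = old s-in-t

[m*n+r]%n≡r : ∀ m {n r} .{{_ : NonZero n}} → r < n → (m * n + r) % n ≡ r
[m*n+r]%n≡r m {n} {r} r<n = trans (%-remove-+ˡ r (n∣m*n m)) (m<n⇒m%n≡m r<n)

[m*n+r]/n≡m : ∀ m {n r} .{{_ : NonZero n}} → r < n → (m * n + r) / n ≡ m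
[m*n+r]/n≡m m {n} {r} r<n = begin
  (m * n + r) / n   ≡⟨ +-distrib-/-∣ˡ r (n∣m*n m) ⟩
  m * n / n + r / n ≡⟨ cong₂ _+_ (m*n/n≡m m n) (m<n⇒m/n≡0 r<n) ⟩
  m + 0             ≡⟨ +-identityʳ m ⟩
  m                 ∎
  where open ≡-Reasoning

module Cyclic (N : ℕ) .{{_ : NonZero N}} where

  next prev : ℕ → ℕ
  next c = suc c % N
  prev c = (c + pred N) % N

  [k+t%N]%N≡[k+t]%N : ∀ k t → (k + t % N) % N ≡ (k + t) % N
  [k+t%N]%N≡[k+t]%N k t = begin
    (k + t % N) % N               ≡⟨ [m+kn]%n≡m%n (k + t % N) (t / N) N ⟨
    (k + t % N + t / N * N) % N   ≡⟨ %-congˡ (+-assoc k (t % N) _) ⟩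
    (k + (t % N + t / N * N)) % N ≡⟨ cong (λ u → (k + u) % N) (m≡m%n+[m/n]*n t N) ⟨
    (k + t) % N                   ∎
    where open ≡-Reasoning

  next-% : ∀ t → next (t % N) ≡ next t
  next-% = [k+t%N]%N≡[k+t]%N 1

  prev-next : ∀ {c} → c < N → prev (next c) ≡ c
  prev-next {c} c<N = begin
    (suc c % N + pred N) % N ≡⟨ %-congˡ (+-comm (suc c % N) (pred N)) ⟩
    (pred N + suc c % N) % N ≡⟨ [k+t%N]%N≡[k+t]%N (pred N) (suc c) ⟩
    (pred N + suc c) % N     ≡⟨ %-congˡ (trans (+-suc (pred N) c) (cong (_+ c) (suc-pred N))) ⟩
    (N + c) % N              ≡⟨ %-congˡ (+-comm N c) ⟩
    (c + N) % N              ≡⟨ [m+n]%n≡m%n c N ⟩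
    c % N                    ≡⟨ m<n⇒m%n≡m c<N ⟩
    c                        ∎
    where open ≡-Reasoning

  next-injective : ∀ {c d} → c < N → d < N → next c ≡ next d → c ≡ d
  next-injective {c} {d} c<N d<N eq =
    trans (sym (prev-next c<N)) (trans (cong prev eq) (prev-next d<N))

  Near : ℕ → ℕ → Set
  Near c d = d ≡ c ⊎ d ≡ next c ⊎ c ≡ next d

  Near-sym : ∀ {c d} → Near c d → Near d c
  Near-sym (inj₁ d≡c)        = inj₁ (sym d≡c)
  Near-sym (inj₂ (inj₁ d≡c⁺)) = inj₂ (inj₂ d≡c⁺)
  Near-sym (inj₂ (inj₂ c≡d⁺)) = inj₂ (inj₁ c≡d⁺)

  near? : ∀ c d → Dec (Near c d)
  near? c d = (d ≟ c) ⊎-dec ((d ≟ next c) ⊎-dec (c ≟ next d))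

  Near⇒∈ : ∀ {c d} → d < N → Near c d → d ∈ c ∷ next c ∷ prev c ∷ []
  Near⇒∈ d<N (inj₁ d≡c)         = here d≡c
  Near⇒∈ d<N (inj₂ (inj₁ d≡c⁺)) = there (here d≡c⁺)
  Near⇒∈ d<N (inj₂ (inj₂ c≡d⁺)) = there (there (here (trans (sym (prev-next d<N)) (cong prev (sym c≡d⁺)))))

-- The gadget on an abstract list of copies

-- QAdj, InClosedNbhdCopies, AddedEdge and GEdge for an arbitrary list Q of copy-labelled
-- vertices: GEdge P unfolds to Edge (Qpath P).  Keeping Q abstract below stops Agda from
-- unfolding the b copies of Qpath P.
module _ {C X : Set} where

  Adjacent : List (C × X) → C × X → C × X → Set
  Adjacent Q v w = Consec Q v w ⊎ Consec Q w v

  InCopyNbhd : List (C × X) → C × X → C × X → Set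
  InCopyNbhd Q x y = Σ (C × X) λ z → (proj₂ z ≡ proj₂ x) × ((y ≡ z) ⊎ Adjacent Q y z)

  Added : List (C × X) → C × X → C × X → Set
  Added Q x y = (proj₁ x ≢ proj₁ y) × ¬ InCopyNbhd Q x y

  Edge : List (C × X) → C × X → C × X → Set
  Edge Q x y = Adjacent Q x y ⊎ (Added Q x y ⊎ Added Q y x)

module Gadget {X : Set} (_≟ˣ_ : DecidableEquality X) (P : List X) (P-unique : Unique P)
              .{{_ : NonZero (length P)}} {B : ℕ} (Q : List (Fin B × X))
              (Q≡cartesianProduct : Q ≡ cartesianProduct (allFin B) P) where

  open Cyclic (length P)

  V : Set
  V = Fin B × X

  _≟ⱽ_ : DecidableEquality V
  _≟ⱽ_ = ≡-dec Fin._≟_ _≟ˣ_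

  pos : V → ℕ
  pos = position _≟ⱽ_ Q

  phase : V → ℕ
  phase w = position _≟ˣ_ P (proj₂ w)

  copy : V → ℕ
  copy w = toℕ (proj₁ w)

  Q-unique : Unique Q
  Q-unique = subst Unique (sym Q≡cartesianProduct) (cartesianProduct⁺ (allFin⁺ B) P-unique)

  ∈-Q⁺ : ∀ {c p} → p ∈ P → (c , p) ∈ Q
  ∈-Q⁺ {c} {p} p∈P = subst ((c , p) ∈_) (sym Q≡cartesianProduct) (∈-cartesianProduct⁺ (∈-allFin c) p∈P)

  ∈-Q⁻ : ∀ {w} → w ∈ Q → proj₂ w ∈ P
  ∈-Q⁻ {w} w∈Q = proj₂ (∈-cartesianProduct⁻ (allFin B) P (subst (w ∈_) Q≡cartesianProduct w∈Q))

  phase<length : ∀ {w} → w ∈ Q → phase w < length P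
  phase<length w∈Q = Position.position-< _≟ˣ_ (∈-Q⁻ w∈Q)

  pos<length : ∀ {w} → w ∈ Q → pos w < length Q
  pos<length = Position.position-< _≟ⱽ_

  pos-decomposition : ∀ {w} → w ∈ Q → pos w ≡ copy w * length P + phase w
  pos-decomposition {c , p} w∈Q = begin
    pos (c , p)
      ≡⟨ cong (λ L → position _≟ⱽ_ L (c , p)) Q≡cartesianProduct ⟩
    position _≟ⱽ_ (cartesianProduct (allFin B) P) (c , p)
      ≡⟨ position-cartesianProduct Fin._≟_ _≟ˣ_ (∈-allFin c) (∈-Q⁻ w∈Q) ⟩
    position Fin._≟_ (allFin B) c * length P + phase (c , p)
      ≡⟨ cong (λ i → i * length P + phase (c , p)) (position-tabulate Fin._≟_ id c) ⟩
    toℕ c * length P + phase (c , p)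
      ∎
    where open ≡-Reasoning

  pos%length≡phase : ∀ {w} → w ∈ Q → pos w % length P ≡ phase w
  pos%length≡phase {w} w∈Q = trans (%-congˡ (pos-decomposition w∈Q)) ([m*n+r]%n≡r (copy w) (phase<length w∈Q))

  pos/length≡copy : ∀ {w} → w ∈ Q → pos w / length P ≡ copy w
  pos/length≡copy {w} w∈Q = trans (/-congˡ (pos-decomposition w∈Q)) ([m*n+r]/n≡m (copy w) (phase<length w∈Q))

  copy-mono : ∀ {v w} → v ∈ Q → w ∈ Q → pos v ≤ pos w → copy v ≤ copy w
  copy-mono v∈Q w∈Q v≤w = subst₂ _≤_ (pos/length≡copy v∈Q) (pos/length≡copy w∈Q) (/-monoˡ-≤ (length P) v≤w)

  copy-at : ∀ {t p} → t < length Q → p ∈ P → position _≟ˣ_ P p ≡ t % length P → ∃[ c ] pos (c , p) ≡ t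
  copy-at {t} {p} t<len p∈P p-at = proj₁ w , (begin
    pos (proj₁ w , p)                      ≡⟨ pos-decomposition (∈-Q⁺ p∈P) ⟩
    copy w * length P + position _≟ˣ_ P p ≡⟨ cong (copy w * length P +_) (trans p-at (%-congˡ (sym pos-w))) ⟩
    copy w * length P + pos w % length P   ≡⟨ cong (copy w * length P +_) (pos%length≡phase w∈Q) ⟩
    copy w * length P + phase w            ≡⟨ pos-decomposition w∈Q ⟨
    pos w                                  ≡⟨ pos-w ⟩
    t                                      ∎)
    where
    open ≡-Reasoning
    w = lookup Q (fromℕ< t<len)
    w∈Q = ∈-lookup (fromℕ< t<len)
    pos-w = trans (Position.position-lookup _≟ⱽ_ Q-unique (fromℕ< t<len)) (toℕ-fromℕ< t<len)

  Consec⇒pos-suc : ∀ {v w} → Consec Q v w → pos w ≡ suc (pos v)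
  Consec⇒pos-suc = Position.Consec⇒position-suc _≟ⱽ_ Q-unique

  pos-suc⇒Consec : ∀ {v w} → v ∈ Q → w ∈ Q → pos w ≡ suc (pos v) → Consec Q v w
  pos-suc⇒Consec = Position.position-suc⇒Consec _≟ⱽ_

  phase-suc : ∀ {v w} → v ∈ Q → w ∈ Q → pos w ≡ suc (pos v) → phase w ≡ next (phase v)
  phase-suc {v} {w} v∈Q w∈Q w-after-v = begin
    phase w                 ≡⟨ pos%length≡phase w∈Q ⟨
    pos w % length P        ≡⟨ %-congˡ w-after-v ⟩
    next (pos v)            ≡⟨ next-% (pos v) ⟨
    next (pos v % length P) ≡⟨ cong next (pos%length≡phase v∈Q) ⟩
    next (phase v)          ∎
    where open ≡-Reasoning

  Adjacent⇒InCopyNbhd : ∀ {x y} → Adjacent Q x y → InCopyNbhd Q x y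
  Adjacent⇒InCopyNbhd {x} x~y = x , refl , inj₂ (Sum.swap x~y)

  InCopyNbhd⇒Near : ∀ {x y} → InCopyNbhd Q x y → Near (phase x) (phase y)
  InCopyNbhd⇒Near (z , z≈x , inj₁ refl) = inj₁ (cong (position _≟ˣ_ P) z≈x)
  InCopyNbhd⇒Near (z , z≈x , inj₂ (inj₁ y→z)) =
    inj₂ (inj₂ (trans (cong (position _≟ˣ_ P) (sym z≈x))
                      (phase-suc (Consec-∈ˡ y→z) (Consec-∈ʳ y→z) (Consec⇒pos-suc y→z))))
  InCopyNbhd⇒Near (z , z≈x , inj₂ (inj₂ z→y)) =
    inj₂ (inj₁ (trans (phase-suc (Consec-∈ˡ z→y) (Consec-∈ʳ z→y) (Consec⇒pos-suc z→y))
                      (cong (next ∘ position _≟ˣ_ P) z≈x)))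

  copy-before : ∀ {x y t} → x ∈ Q → y ∈ Q → phase y ≡ next (phase x) → pos y ≡ suc t → InCopyNbhd Q x y
  copy-before {x} {y} {t} x∈Q y∈Q y-after-x pos-y =
    let c , pos-z = copy-at t<len (∈-Q⁻ x∈Q) x-at-t
    in (c , proj₂ x) , refl ,
       inj₂ (inj₂ (pos-suc⇒Consec (∈-Q⁺ (∈-Q⁻ x∈Q)) y∈Q (trans pos-y (cong suc (sym pos-z)))))
    where
    t<len : t < length Q
    t<len = <-trans (n<1+n t) (subst (_< length Q) pos-y (pos<length y∈Q))
    x-at-t : phase x ≡ t % length P
    x-at-t = next-injective (phase<length x∈Q) (m%n<n t (length P)) (begin
      next (phase x)      ≡⟨ y-after-x ⟨
      phase y             ≡⟨ pos%length≡phase y∈Q ⟨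
      pos y % length P    ≡⟨ %-congˡ pos-y ⟩
      next t              ≡⟨ next-% t ⟨
      next (t % length P) ∎)
      where open ≡-Reasoning

  copy-after : ∀ {x y} → x ∈ Q → y ∈ Q → phase x ≡ next (phase y) → suc (pos y) < length Q →
               InCopyNbhd Q x y
  copy-after {x} {y} x∈Q y∈Q x-after-y y-not-last =
    let c , pos-z = copy-at y-not-last (∈-Q⁻ x∈Q) x-at
    in (c , proj₂ x) , refl , inj₂ (inj₁ (pos-suc⇒Consec y∈Q (∈-Q⁺ (∈-Q⁻ x∈Q)) pos-z))
    where
    x-at : phase x ≡ suc (pos y) % length P
    x-at = trans x-after-y (trans (cong next (sym (pos%length≡phase y∈Q))) (next-% (pos y)))

  Near∧∉InCopyNbhd⇒end : ∀ {x y} → x ∈ Q → y ∈ Q → Near (phase x) (phase y) → ¬ InCopyNbhd Q x y →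
                         pos y ≡ 0 ⊎ suc (pos y) ≡ length Q
  Near∧∉InCopyNbhd⇒end {x} {y} x∈Q y∈Q (inj₁ same-phase) ∉N[x] =
    ⊥-elim (∉N[x] (y , Position.position-injective _≟ˣ_ (∈-Q⁻ y∈Q) (∈-Q⁻ x∈Q) same-phase , inj₁ refl))
  Near∧∉InCopyNbhd⇒end {x} {y} x∈Q y∈Q (inj₂ (inj₁ y-after-x)) ∉N[x] with pos y in pos-y
  ... | zero  = inj₁ refl
  ... | suc t = ⊥-elim (∉N[x] (copy-before x∈Q y∈Q y-after-x pos-y))
  Near∧∉InCopyNbhd⇒end {x} {y} x∈Q y∈Q (inj₂ (inj₂ x-after-y)) ∉N[x] with suc (pos y) <? length Q
  ... | yes y-not-last = ⊥-elim (∉N[x] (copy-after x∈Q y∈Q x-after-y y-not-last))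
  ... | no  y-last     = inj₂ (≤-antisym (pos<length y∈Q) (≮⇒≥ y-last))

  crossing-near-edge : ∀ {j x y} → x ∈ Q → y ∈ Q → pos x < j → j ≤ pos y → Edge Q x y →
                       Near (phase x) (phase y) → suc (pos x) ≡ j ⊎ pos x ≡ 0 ⊎ suc (pos y) ≡ length Q
  crossing-near-edge {j} x∈Q y∈Q x<j j≤y (inj₁ (inj₁ x→y)) _ =
    inj₁ (≤-antisym x<j (subst (j ≤_) (Consec⇒pos-suc x→y) j≤y))
  crossing-near-edge {j} {x} {y} x∈Q y∈Q x<j j≤y (inj₁ (inj₂ y→x)) _ =
    ⊥-elim (<-asym (<-≤-trans x<j j≤y) (subst (pos y <_) (sym (Consec⇒pos-suc y→x)) (n<1+n (pos y))))
  crossing-near-edge {j} x∈Q y∈Q x<j j≤y (inj₂ (inj₁ (_ , ∉N[x]))) near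
    with Near∧∉InCopyNbhd⇒end x∈Q y∈Q near ∉N[x]
  ... | inj₁ y-first = ⊥-elim (n≮0 (<-≤-trans x<j (subst (j ≤_) y-first j≤y)))
  ... | inj₂ y-last  = inj₂ (inj₂ y-last)
  crossing-near-edge x∈Q y∈Q x<j j≤y (inj₂ (inj₂ (_ , ∉N[y]))) near
    with Near∧∉InCopyNbhd⇒end y∈Q x∈Q (Near-sym near) ∉N[y]
  ... | inj₁ x-first = inj₂ (inj₁ x-first)
  ... | inj₂ x-last  = ⊥-elim (<-irrefl x-last (≤-<-trans (≤-trans x<j j≤y) (pos<length y∈Q)))

  module PrefixCut (pre rest : List V) (Q≡pre++rest : Q ≡ pre ++ rest)
                   {m} {M : Fin m → V × V}
                   (matching : IsInducedMatching (λ v → v ∈ pre) (λ w → w ∈ Q × w ∉ pre) (Edge Q) m M)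
                   where

    x y : Fin m → V
    x k = proj₁ (M k)
    y k = proj₂ (M k)

    α β : Fin m → ℕ
    α k = phase (x k)
    β k = phase (y k)

    edge : ∀ k → Edge Q (x k) (y k)
    edge k = proj₂ (proj₂ (proj₁ matching k))

    x∈Q : ∀ k → x k ∈ Q
    x∈Q k = subst (x k ∈_) (sym Q≡pre++rest) (∈-++⁺ˡ (proj₁ (proj₁ matching k)))

    y∈Q : ∀ k → y k ∈ Q
    y∈Q k = proj₁ (proj₁ (proj₂ (proj₁ matching k)))

    j : ℕ
    j = length pre

    pos-in-cut : ∀ w → pos w ≡ position _≟ⱽ_ (pre ++ rest) w
    pos-in-cut w = cong (λ L → position _≟ⱽ_ L w) Q≡pre++rest

    x<j : ∀ k → pos (x k) < j
    x<j k = subst (_< j) (sym (trans (pos-in-cut (x k)) (position-++ˡ _≟ⱽ_ pre rest x∈pre)))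
                  (Position.position-< _≟ⱽ_ x∈pre)
      where x∈pre = proj₁ (proj₁ matching k)

    j≤y : ∀ k → j ≤ pos (y k)
    j≤y k = subst (j ≤_) (sym (trans (pos-in-cut (y k)) (position-++ʳ _≟ⱽ_ pre rest y∉pre)))
                  (m≤m+n j _)
      where y∉pre = proj₂ (proj₁ (proj₂ (proj₁ matching k)))

    x≤y : ∀ k l → pos (x k) ≤ pos (y l)
    x≤y k l = <⇒≤ (<-≤-trans (x<j k) (j≤y l))

    sameCopy⇒Near : ∀ {k} → proj₁ (x k) ≡ proj₁ (y k) → Near (α k) (β k)
    sameCopy⇒Near {k} same with edge k
    ... | inj₁ x~y                 = InCopyNbhd⇒Near {x k} {y k} (Adjacent⇒InCopyNbhd x~y)
    ... | inj₂ (inj₁ (differ , _)) = contradiction same differ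
    ... | inj₂ (inj₂ (differ , _)) = contradiction (sym same) differ

    differentCopies⇒Near : ∀ {k l} → k ≢ l → proj₁ (x k) ≢ proj₁ (y l) → Near (α k) (β l)
    differentCopies⇒Near {k} {l} k≢l differ with near? (α k) (β l)
    ... | yes near = near
    ... | no far   = ⊥-elim (proj₂ matching k l k≢l (inj₂ (inj₁ (differ , far ∘ InCopyNbhd⇒Near {x k} {y l}))))

    -- A crossing pair x_k, y_l inside one copy can only lie in the copy containing the cut.
    crossing-copies-equal : ∀ {k l k′ l′} → proj₁ (x k) ≡ proj₁ (y l) → proj₁ (x k′) ≡ proj₁ (y l′) →
                            proj₁ (x k) ≡ proj₁ (x k′)
    crossing-copies-equal {k} {l} {k′} {l′} k~l k′~l′ = toℕ-injective (≤-antisym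
      (subst (copy (x k) ≤_) (cong toℕ (sym k′~l′)) (copy-mono (x∈Q k) (y∈Q l′) (x≤y k l′)))
      (subst (copy (x k′) ≤_) (cong toℕ (sym k~l)) (copy-mono (x∈Q k′) (y∈Q l) (x≤y k′ l))))

    Far : Fin m → Set
    Far k = ¬ Near (α k) (β k)

    far⇒differentCopies : ∀ {k} → Far k → proj₁ (x k) ≢ proj₁ (y k)
    far⇒differentCopies far = far ∘ sameCopy⇒Near

    far-pair : ∀ {k l} → Far k → k ≢ l → Near (α k) (β l) ⊎ Near (α l) (β k)
    far-pair {k} {l} far-k k≢l with proj₁ (x k) Fin.≟ proj₁ (y l)
    ... | no differ = inj₁ (differentCopies⇒Near k≢l differ)
    ... | yes k~l   = inj₂ (differentCopies⇒Near (k≢l ∘ sym)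
                             (λ l~k → far⇒differentCopies far-k (trans (crossing-copies-equal k~l l~k) l~k)))

    farα-injective : ∀ {k l} → Far k → Far l → α k ≡ α l → k ≡ l
    farα-injective {k} {l} far-k far-l eq with k Fin.≟ l
    ... | yes k≡l = k≡l
    ... | no k≢l  = ⊥-elim ([ far-l ∘ subst (λ a → Near a (β l)) eq
                              , far-k ∘ subst (λ a → Near a (β k)) (sym eq) ]′ (far-pair far-k k≢l))

    farβ-injective : ∀ {k l} → Far k → Far l → β k ≡ β l → k ≡ l
    farβ-injective {k} {l} far-k far-l eq with k Fin.≟ l
    ... | yes k≡l = k≡l
    ... | no k≢l  = ⊥-elim ([ far-k ∘ subst (Near (α k)) (sym eq)
                              , far-l ∘ subst (Near (α l)) eq ]′ (far-pair far-k k≢l))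

    nearLabels : List ℕ
    nearLabels = j ∷ 0 ∷ pred j ∷ []

    -- By crossing-near-edge a near edge is the path edge over the cut (labelled pred j), starts
    -- at the first vertex of Q (labelled 0) or ends at its last vertex (labelled j).
    nearLabel : Fin m → ℕ
    nearLabel k with suc (pos (y k)) ≟ length Q
    ... | yes _ = j
    ... | no  _ = pos (x k)

    nearLabel-injective : ∀ {k l} → nearLabel k ≡ nearLabel l → k ≡ l
    nearLabel-injective {k} {l} eq with suc (pos (y k)) ≟ length Q | suc (pos (y l)) ≟ length Q
    ... | yes k-last | yes l-last = inducedMatching-injectiveʳ (Edge Q) M edge (proj₂ matching)
            (Position.position-injective _≟ⱽ_ (y∈Q k) (y∈Q l) (suc-injective (trans k-last (sym l-last))))
    ... | yes _ | no _ = contradiction (sym eq) (<⇒≢ (x<j l))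
    ... | no _ | yes _ = contradiction eq (<⇒≢ (x<j k))
    ... | no _ | no _  = inducedMatching-injectiveˡ (Edge Q) M edge (proj₂ matching)
            (Position.position-injective _≟ⱽ_ (x∈Q k) (x∈Q l) eq)

    nearLabel∈ : ∀ {k} → Near (α k) (β k) → nearLabel k ∈ nearLabels
    nearLabel∈ {k} near with suc (pos (y k)) ≟ length Q
    ... | yes _ = here refl
    ... | no not-last with crossing-near-edge (x∈Q k) (y∈Q k) (x<j k) (j≤y k) (edge k) near
    ...   | inj₁ x-before-cut   = there (there (here (cong pred x-before-cut)))
    ...   | inj₂ (inj₁ x-first) = there (here x-first)
    ...   | inj₂ (inj₂ y-last)  = contradiction y-last not-last

    far-labelled⇒≤7 : (φ : Fin m → ℕ) (c v : ℕ) → (∀ k → φ k < length P) →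
                      (∀ {k l} → Far k → Far l → φ k ≡ φ l → k ≡ l) →
                      (∀ {k} → Far k → φ k ≡ v ⊎ Near c (φ k)) → m ≤ 7
    far-labelled⇒≤7 φ c v φ<length φ-injective φ-range =
      injective-into-list⇒≤ {xs = labels} label-injective label∈labels
      where
      farLabels : List ℕ
      farLabels = v ∷ c ∷ next c ∷ prev c ∷ []

      labels : List (ℕ ⊎ ℕ)
      labels = map inj₁ farLabels ++ map inj₂ nearLabels

      label : Fin m → ℕ ⊎ ℕ
      label k with near? (α k) (β k)
      ... | yes _ = inj₂ (nearLabel k)
      ... | no  _ = inj₁ (φ k)

      label-injective : Injective _≡_ _≡_ label
      label-injective {k} {l} eq with near? (α k) (β k) | near? (α l) (β l)
      ... | yes _     | yes _     = nearLabel-injective (inj₂-injective eq)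
      ... | no  far-k | no  far-l = φ-injective far-k far-l (inj₁-injective eq)

      label∈labels : ∀ k → label k ∈ labels
      label∈labels k with near? (α k) (β k)
      ... | yes near = ∈-++⁺ʳ (map inj₁ farLabels) (∈-map⁺ inj₂ (nearLabel∈ near))
      ... | no  far  = ∈-++⁺ˡ {ys = map inj₂ nearLabels}
                         (∈-map⁺ inj₁ ([ here , there ∘ Near⇒∈ (φ<length k) ]′ (φ-range far)))

    matching-≤7 : m ≤ 7
    matching-≤7 with any? (λ k → ¬? (near? (α k) (β k)))
    ... | no no-far = far-labelled⇒≤7 α 0 0 (phase<length ∘ x∈Q) farα-injective
                        (λ {k} far → contradiction (k , far) no-far)
    ... | yes (f , far-f) with any? (λ l → proj₁ (x f) Fin.≟ proj₁ (y l))
    ...   | no unshared = far-labelled⇒≤7 β (α f) (β f) (phase<length ∘ y∈Q) farβ-injective range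
      where
      range : ∀ {k} → Far k → β k ≡ β f ⊎ Near (α f) (β k)
      range {k} _ with k Fin.≟ f
      ... | yes refl = inj₁ refl
      ... | no  k≢f  = inj₂ (differentCopies⇒Near (k≢f ∘ sym) (λ f~k → unshared (k , f~k)))
    ...   | yes (l , f~l) = far-labelled⇒≤7 α (β f) (α f) (phase<length ∘ x∈Q) farα-injective range
      where
      range : ∀ {k} → Far k → α k ≡ α f ⊎ Near (β f) (α k)
      range {k} _ with k Fin.≟ f
      ... | yes refl = inj₁ refl
      ... | no  k≢f  = inj₂ (Near-sym (differentCopies⇒Near k≢f
                         (λ k~f → far⇒differentCopies far-f (trans (crossing-copies-equal f~l k~f) k~f))))

-- The path P_u

PVtx-≡-dec : ∀ {X : Set} → DecidableEquality X → DecidableEquality (PVtx X)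
PVtx-≡-dec _≟ˣ_ (orig x) (orig y) = map′ (cong orig) (λ { refl → refl }) (x ≟ˣ y)
PVtx-≡-dec _≟ˣ_ (subd x) (subd y) = map′ (cong subd) (λ { refl → refl }) (x ≟ˣ y)
PVtx-≡-dec _≟ˣ_ new      new      = yes refl
PVtx-≡-dec _≟ˣ_ (orig _) (subd _) = no λ ()
PVtx-≡-dec _≟ˣ_ (orig _) new      = no λ ()
PVtx-≡-dec _≟ˣ_ (subd _) (orig _) = no λ ()
PVtx-≡-dec _≟ˣ_ (subd _) new      = no λ ()
PVtx-≡-dec _≟ˣ_ new      (orig _) = no λ ()
PVtx-≡-dec _≟ˣ_ new      (subd _) = no λ ()

subdivPlus-nonZero : ∀ {X : Set} (xs : List X) → NonZero (length (subdivPlus xs))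
subdivPlus-nonZero []           = _
subdivPlus-nonZero (_ ∷ [])     = _
subdivPlus-nonZero (_ ∷ _ ∷ _)  = _

orig∈subdivPlus⇒∈ : ∀ {X : Set} {z : X} xs → orig z ∈ subdivPlus xs → z ∈ xs
orig∈subdivPlus⇒∈ []           (here ())
orig∈subdivPlus⇒∈ []           (there ())
orig∈subdivPlus⇒∈ (_ ∷ [])     (here refl)          = here refl
orig∈subdivPlus⇒∈ (_ ∷ [])     (there (here ()))
orig∈subdivPlus⇒∈ (_ ∷ [])     (there (there ()))
orig∈subdivPlus⇒∈ (_ ∷ _ ∷ _)  (here refl)          = here refl
orig∈subdivPlus⇒∈ (_ ∷ _ ∷ _)  (there (here ()))
orig∈subdivPlus⇒∈ (_ ∷ y ∷ xs) (there (there z∈)) = there (orig∈subdivPlus⇒∈ (y ∷ xs) z∈)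

subd∈subdivPlus⇒∈ : ∀ {X : Set} {z : X} xs → subd z ∈ subdivPlus xs → z ∈ xs
subd∈subdivPlus⇒∈ []           (here ())
subd∈subdivPlus⇒∈ []           (there ())
subd∈subdivPlus⇒∈ (_ ∷ [])     (here ())
subd∈subdivPlus⇒∈ (_ ∷ [])     (there (here ()))
subd∈subdivPlus⇒∈ (_ ∷ [])     (there (there ()))
subd∈subdivPlus⇒∈ (_ ∷ _ ∷ _)  (here ())
subd∈subdivPlus⇒∈ (_ ∷ _ ∷ _)  (there (here refl))  = here refl
subd∈subdivPlus⇒∈ (_ ∷ y ∷ xs) (there (there z∈)) = there (subd∈subdivPlus⇒∈ (y ∷ xs) z∈)

subdivPlus⁺ : ∀ {X : Set} {xs : List X} → Unique xs → Unique (subdivPlus xs)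
subdivPlus⁺ {xs = []}         _ = All.[] ∷ []
subdivPlus⁺ {xs = _ ∷ []}     _ = ((λ ()) All.∷ All.[]) ∷ All.[] ∷ []
subdivPlus⁺ {xs = x ∷ y ∷ xs} u@(_ ∷ u′) =
  ((λ ()) All.∷ All.¬Any⇒All¬ _ (x∉ ∘ orig∈subdivPlus⇒∈ (y ∷ xs))) ∷
  All.¬Any⇒All¬ _ (x∉ ∘ subd∈subdivPlus⇒∈ (y ∷ xs)) ∷
  subdivPlus⁺ u′
  where x∉ = Unique[x∷xs]⇒x∉xs u

Ipart-coordinates : ∀ H u v i {e} → e ∈ Ipart H u v i → proj₁ e ≡ v × proj₁ (proj₂ e) ≡ i
Ipart-coordinates H u v i e∈ with ∈-map⁻ _ e∈
... | _ , _ , refl = refl , refl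

Ppath-unique : ∀ H u {vs} → Unique vs → Unique (Ppath H u vs)
Ppath-unique H u {vs} vs-unique = subdivPlus⁺ (concatMap⁺ (proj₁ ∘ proj₂) level Lpart-unique (allFin⁺ a))
  where
  Lpart-unique : ∀ i → Unique (Lpart H u vs i)
  Lpart-unique i = concatMap⁺ proj₁ (λ v e∈ → proj₁ (Ipart-coordinates H u v i e∈))
                              (λ v → map⁺ (λ { refl → refl }) (upTo⁺ _)) vs-unique
  level : ∀ i {e} → e ∈ Lpart H u vs i → proj₁ (proj₂ e) ≡ i
  level i e∈ with satisfied (∈-concatMap⁻ (λ v → Ipart H u v i) {xs = vs} e∈)
  ... | v , e∈Ipart = proj₂ (Ipart-coordinates H u v i e∈Ipart)

copies : ∀ {X : Set} → List X → List (Fin b) → List (QVtx X)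
copies P cs = concatMap (λ c → map (λ x → (c , x)) P) cs

copies≡cartesianProduct : ∀ {X : Set} (P : List X) cs → copies P cs ≡ cartesianProduct cs P
copies≡cartesianProduct P []       = refl
copies≡cartesianProduct P (c ∷ cs) = cong (map (c ,_) P ++_) (copies≡cartesianProduct P cs)

Qpath≡cartesianProduct : ∀ {X : Set} (P : List X) → Qpath P ≡ cartesianProduct (allFin b) P
Qpath≡cartesianProduct P = copies≡cartesianProduct P (allFin b)

caterpillarCut-inducedMatching-≤7 :
  ∀ {X : Set} → DecidableEquality X → (P : List X) → Unique P → .{{_ : NonZero (length P)}} →
  ∀ s → NonRootNode s (caterpillar (Qpath P)) → ∀ m (M : Fin m → QVtx X × QVtx X) →
  IsInducedMatching (λ x → x ∈ leaves s) (λ y → (y ∈ Qpath P) × (y ∉ leaves s)) (GEdge P) m M →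
  m ≤ 7
caterpillarCut-inducedMatching-≤7 _≟ˣ_ P P-unique s s-edge m M matching =
  [ prefix-bound , leaf-bound ]′ (caterpillar-cut (Qpath P) s-edge)
  where
  open Gadget _≟ˣ_ P P-unique (Qpath P) (Qpath≡cartesianProduct P)

  prefix-bound : ∃[ rest ] Qpath P ≡ leaves s ++ rest → m ≤ 7
  prefix-bound (rest , Qpath≡s++rest) =
    PrefixCut.matching-≤7 (leaves s) rest Qpath≡s++rest {m} {M} matching

  leaf-bound : ∃[ q ] leaves s ≡ q ∷ [] → m ≤ 7
  leaf-bound (q , s≡[q]) =
    ≤-trans (injective-into-list⇒≤ (inducedMatching-injectiveˡ (GEdge P) M edge (proj₂ matching)) x∈[q])
            (s≤s z≤n)
    where
    edge : ∀ k → GEdge P (proj₁ (M k)) (proj₂ (M k))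
    edge k = proj₂ (proj₂ (proj₁ matching k))
    x∈[q] : ∀ k → proj₁ (M k) ∈ q ∷ []
    x∈[q] k = subst (proj₁ (M k) ∈_) s≡[q] (proj₁ (proj₁ matching k))

-- X is passed explicitly below: inferring it in unfolded form would make Agda unfold
-- Qpath (Ppath H u vs) when comparing the two statements.
lemma25 : (H : WGraph) → WeightsPosMultOf a H →
          (u : Fin (n H)) → (vs : List (Fin (n H))) → Enumerates H u vs →
          (s : Tree (QVtx (PVtx (LVtx (n H))))) →
          NonRootNode s (caterpillar (Qpath (Ppath H u vs))) →
          (m : ℕ) → (M : Fin m → QVtx (PVtx (LVtx (n H))) × QVtx (PVtx (LVtx (n H)))) →
          IsInducedMatching (λ x → x ∈ leaves s)
                            (λ y → (y ∈ Qpath (Ppath H u vs)) × (y ∉ leaves s))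
                            (GEdge (Ppath H u vs)) m M →
          m ≤ 7
lemma25 H _ u vs (vs-unique , _) =
  caterpillarCut-inducedMatching-≤7 {X = PVtx (LVtx (n H))}
    (PVtx-≡-dec (≡-dec Fin._≟_ (≡-dec Fin._≟_ _≟_))) (Ppath H u vs) (Ppath-unique H u vs-unique)
    {{subdivPlus-nonZero (Lpath H u vs)}}
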